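{- Let $p$ be a phinary number and $n\ge0$ an integer with $p\le\phi^n$, and assume $(n,p)\neq(0,1)$ and $(n,p)\neq(1,\phi)$. Then $p+\phi^n$ is a phinary number.
   Context: Let $\phi=\frac{1+\sqrt5}{2}$ and $\psi=1/\phi$. The Fibonacci words over $\{A,B\}$ are $w_1=A$, $w_2=AB$, $w_{n+2}=w_{n+1}w_n$; each is a prefix of the next, and the infinite Fibonacci word $c_1c_2c_3\cdots=ABAABABAAB\cdots$ is their common extension. Give the letters values $v(A)=1$, $v(B)=\psi$, and set $p_0=0$, $p_m=\sum_{i=1}^m v(c_i)$ for $m\ge1$. The phinary numbers are the elements of $\mathbb{Z}^+_\Phi=\{p_m: m\ge1\}$ (so $1,\phi,\phi+1,\phi+2,2\phi+1,\dots$). -}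

module Defs where

open import Data.Nat using (ℕ; zero; suc)
open import Data.Integer using (ℤ; +_; -_; _+_; _*_; _-_; _≤_; _<_)
open import Data.Product using (_×_; _,_; Σ; proj₁; proj₂)
open import Data.Sum using (_⊎_)
open import Data.List using (List; []; _∷_; _++_)

-- The ring ℤ[φ]: a pair (a , b) stands for the real number a + b·φ.
-- Since φ is irrational this representation is unique, so propositional
-- equality of pairs is equality of the real numbers.

Zφ : Set
Zφ = ℤ × ℤ

_+φ_ : Zφ → Zφ → Zφ
(a , b) +φ (c , d) = (a + c , b + d)

_-φ_ : Zφ → Zφ → Zφ
(a , b) -φ (c , d) = (a - c , b - d)

zeroφ : Zφ
zeroφ = (+ 0 , + 0)

oneφ : Zφ
oneφ = (+ 1 , + 0)

φ : Zφ
φ = (+ 0 , + 1)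

-- ψ = 1/φ = φ - 1
ψ : Zφ
ψ = (- (+ 1) , + 1)

-- multiplication by φ, using φ² = φ + 1:  (a + bφ)φ = b + (a + b)φ
timesφ : Zφ → Zφ
timesφ (a , b) = (b , a + b)

φ^ : ℕ → Zφ
φ^ zero    = oneφ
φ^ (suc n) = timesφ (φ^ n)

-- Field norm N(a + bφ) = (a + bφ)(a + bφ̄) = a² + ab − b²
norm : Zφ → ℤ
norm (a , b) = a * a + a * b - b * b

-- a + bφ ≥ 0 as a real number (exact sign test in ℤ[φ]):
--  * a ≥ 0 and b ≥ 0; or
--  * a < 0 < b and bφ ≥ −a, i.e. a² + ab − b² ≤ 0; or
--  * b < 0 ≤ a and a ≥ −bφ, i.e. a² + ab − b² ≥ 0.
NonNeg : Zφ → Set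
NonNeg (a , b) =
  ((+ 0 ≤ a) × (+ 0 ≤ b))
  ⊎ (((a < + 0) × (+ 0 < b)) × (norm (a , b) ≤ + 0))
  ⊎ (((b < + 0) × (+ 0 ≤ a)) × (+ 0 ≤ norm (a , b)))

_≤φ_ : Zφ → Zφ → Set
x ≤φ y = NonNeg (y -φ x)

data Letter : Set where
  A B : Letter

-- fibWord k = w_{k+1}:  w₁ = A, w₂ = AB, w_{n+2} = w_{n+1} w_n
fibWord : ℕ → List Letter
fibWord zero          = A ∷ []
fibWord (suc zero)    = A ∷ B ∷ []
fibWord (suc (suc n)) = fibWord (suc n) ++ fibWord n

-- 0-indexed letter lookup with a default (never used: see below)
letterAt : List Letter → ℕ → Letter
letterAt []       _       = A
letterAt (x ∷ _)  zero    = x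
letterAt (_ ∷ xs) (suc i) = letterAt xs i

-- fibLetter i = c_{i+1}, the (i+1)-th letter of the infinite Fibonacci
-- word.  The word w_{i+1} = fibWord i has length ≥ i+1 and is a prefix
-- of the infinite word, so its letter at 0-based position i is c_{i+1}.
fibLetter : ℕ → Letter
fibLetter i = letterAt (fibWord i) i

val : Letter → Zφ
val A = oneφ
val B = ψ

pos : ℕ → Zφ
pos zero    = zeroφ
pos (suc m) = pos m +φ val (fibLetter m)

Phinary : Zφ → Set
Phinary x = Σ ℕ (λ m → pos (suc m) ≡ x)
  where open import Relation.Binary.PropositionalEquality using (_≡_)

module Submission where

-- Write p_m = pos m and L_n = |w_{n+1}| = len n, so that φ^n is the
-- value of the Fibonacci word w_{n+1}.  The proof has three ingredients.
--
--  (1) w_{n+1} is a prefix of the infinite word c, hence p_{L_n} = φ^n.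
--  (2) For n ≥ 2 the square w_{n+1} w_{n+1} is a prefix of w_{n+3}
--      (w_{n+3} = w_{n+1} w_n w_{n+1} and w_{n+1} = w_n w_{n-1} is a prefix
--      of w_n w_{n+1}).  So w_{n+1} also occurs at position L_n, and the
--      partial sums repeat:  p_{L_n + j} = φ^n + p_j  for j ≤ L_n.
--  (3) Each letter has positive value (1 or ψ), so p_{L_n + j} > φ^n for
--      j ≥ 1; a phinary p = p_m ≤ φ^n must therefore have m ≤ L_n.
--
-- The theorem follows: by (3) m ≤ L_n, and for n ≥ 2 (2) gives
-- p + φ^n = p_{L_n + m}; the cases n = 0, 1 (where L_n ≤ 2) are checked by
-- hand, and they are exactly where the two excluded pairs (n, p) live.

open import Defs
open import Data.Nat using (ℕ; zero; suc; _+_; _∸_; _*_; _≤_; _<_; _≤?_; z≤n; s≤s)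
import Data.Nat.Properties as ℕ
open import Data.Integer as ℤ using (+_; +<+)
import Data.Integer.Properties as ℤ
open import Data.Integer.Tactic.RingSolver using (solve-∀)
open import Data.Product using (_×_; _,_; Σ)
open import Data.Sum using (inj₁; inj₂)
open import Data.List using (List; []; _∷_; _++_; length)
import Data.List.Properties as List
open import Data.Empty using (⊥-elim)
open import Relation.Binary.PropositionalEquality
  using (_≡_; refl; sym; trans; cong; cong₂; subst; module ≡-Reasoning)
open import Relation.Nullary using (¬_; yes; no)

+φ-assoc : ∀ (x y z : Zφ) → (x +φ y) +φ z ≡ x +φ (y +φ z)
+φ-assoc (a , b) (c , d) (e , f) = cong₂ _,_ (ℤ.+-assoc a c e) (ℤ.+-assoc b d f)

+φ-comm : ∀ (x y : Zφ) → x +φ y ≡ y +φ x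
+φ-comm (a , b) (c , d) = cong₂ _,_ (ℤ.+-comm a c) (ℤ.+-comm b d)

+φ-identityˡ : ∀ (x : Zφ) → zeroφ +φ x ≡ x
+φ-identityˡ (a , b) = cong₂ _,_ (ℤ.+-identityˡ a) (ℤ.+-identityˡ b)

+φ-identityʳ : ∀ (x : Zφ) → x +φ zeroφ ≡ x
+φ-identityʳ (a , b) = cong₂ _,_ (ℤ.+-identityʳ a) (ℤ.+-identityʳ b)

φ^-recurrence : ∀ n → φ^ (suc n) +φ φ^ n ≡ φ^ (suc (suc n))
φ^-recurrence n = φ²x≡φx+x (φ^ n)
  where
  φ²x≡φx+x : ∀ x → timesφ x +φ x ≡ timesφ (timesφ x)
  φ²x≡φx+x (a , b) = cong₂ _,_ (ℤ.+-comm b a) (ℤ.+-comm (a ℤ.+ b) b)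

infix 4 _≼_
_≼_ : {A : Set} → List A → List A → Set
xs ≼ zs = Σ (List _) (λ ys → zs ≡ xs ++ ys)

≼-trans : {A : Set} {xs ys zs : List A} → xs ≼ ys → ys ≼ zs → xs ≼ zs
≼-trans {xs = xs} (u , refl) (v , refl) = u ++ v , List.++-assoc xs u v

≼-++ : {A : Set} (zs : List A) {xs ys : List A} → xs ≼ ys → zs ++ xs ≼ zs ++ ys
≼-++ zs {xs} (v , refl) = v , sym (List.++-assoc zs xs v)

letterAt-++ˡ : ∀ xs ys i → i < length xs → letterAt (xs ++ ys) i ≡ letterAt xs i
letterAt-++ˡ (x ∷ xs) ys zero    _         = refl
letterAt-++ˡ (x ∷ xs) ys (suc i) (s≤s i<n) = letterAt-++ˡ xs ys i i<n

letterAt-++ʳ : ∀ xs ys j → letterAt (xs ++ ys) (length xs + j) ≡ letterAt ys j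
letterAt-++ʳ []       ys j = refl
letterAt-++ʳ (x ∷ xs) ys j = letterAt-++ʳ xs ys j

letterAt-≼ : ∀ {xs zs} → xs ≼ zs → ∀ i → i < length xs → letterAt zs i ≡ letterAt xs i
letterAt-≼ {xs} (ys , refl) = letterAt-++ˡ xs ys

len : ℕ → ℕ
len n = length (fibWord n)

len-recurrence : ∀ k → len (suc (suc k)) ≡ len (suc k) + len k
len-recurrence k = List.length-++ (fibWord (suc k))

-- |w_{i+1}| > i, so fibLetter i really reads a letter of fibWord i.
len-big : ∀ i → i < len i
len-big zero          = s≤s z≤n
len-big (suc zero)    = s≤s (s≤s z≤n)
len-big (suc (suc k)) = subst (suc (suc k) <_) (sym (len-recurrence k))
  (subst (_≤ len (suc k) + len k) (ℕ.+-comm (suc (suc k)) 1)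
    (ℕ.+-mono-≤ (len-big (suc k)) (ℕ.≤-<-trans z≤n (len-big k))))

fibWord-≼-suc : ∀ n → fibWord n ≼ fibWord (suc n)
fibWord-≼-suc zero    = B ∷ [] , refl
fibWord-≼-suc (suc n) = fibWord n , refl

fibWord-≼ : ∀ n d → fibWord n ≼ fibWord (d + n)
fibWord-≼ n zero    = [] , sym (List.++-identityʳ (fibWord n))
fibWord-≼ n (suc d) = ≼-trans (fibWord-≼ n d) (fibWord-≼-suc (d + n))

-- w_{k+3} w_{k+3} is a prefix of w_{k+5}: w_{k+5} = w_{k+3} (w_{k+2} w_{k+3})
-- and w_{k+3} = w_{k+2} w_{k+1} is a prefix of w_{k+2} w_{k+3}.
fibWord-square-≼ : ∀ k → fibWord (2 + k) ++ fibWord (2 + k) ≼ fibWord (4 + k)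
fibWord-square-≼ k =
  subst (W₂ ++ W₂ ≼_) (sym (List.++-assoc W₂ W₁ W₂)) (≼-++ W₂ (≼-++ W₁ (fibWord-≼ k 2)))
  where
  W₁ = fibWord (1 + k)
  W₂ = fibWord (2 + k)

-- Occurs xs k : the letters c_{k+1} c_{k+2} ⋯ of the infinite word spell xs.
Occurs : List Letter → ℕ → Set
Occurs xs k = ∀ i → i < length xs → letterAt xs i ≡ fibLetter (k + i)

occurs-≼ : ∀ {xs zs k} → xs ≼ zs → Occurs zs k → Occurs xs k
occurs-≼ {xs} (ys , refl) occ i i<n =
  trans (sym (letterAt-++ˡ xs ys i i<n)) (occ i (subst (i <_) (sym (List.length-++ xs)) (ℕ.≤-trans i<n (ℕ.m≤m+n _ _))))

occurs-++ʳ : ∀ xs ys k → Occurs (xs ++ ys) k → Occurs ys (k + length xs)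
occurs-++ʳ xs ys k occ j j<n = begin
  letterAt ys j                          ≡⟨ sym (letterAt-++ʳ xs ys j) ⟩
  letterAt (xs ++ ys) (length xs + j)    ≡⟨ occ (length xs + j) bound ⟩
  fibLetter (k + (length xs + j))        ≡⟨ cong fibLetter (sym (ℕ.+-assoc k (length xs) j)) ⟩
  fibLetter (k + length xs + j)          ∎
  where
  open ≡-Reasoning
  bound : length xs + j < length (xs ++ ys)
  bound = subst (length xs + j <_) (sym (List.length-++ xs)) (ℕ.+-monoʳ-< (length xs) j<n)

occurs-head : ∀ x xs k → Occurs (x ∷ xs) k → fibLetter k ≡ x
occurs-head x xs k occ = sym (trans (occ 0 (s≤s z≤n)) (cong fibLetter (ℕ.+-identityʳ k)))

occurs-tail : ∀ x xs k → Occurs (x ∷ xs) k → Occurs xs (suc k)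
occurs-tail x xs k occ i i<n = trans (occ (suc i) (s≤s i<n)) (cong fibLetter (ℕ.+-suc k i))

fibWord-occurs : ∀ n → Occurs (fibWord n) 0
fibWord-occurs n i i<n = begin
  letterAt (fibWord n) i        ≡⟨ sym (letterAt-≼ (fibWord-≼ n i) i i<n) ⟩
  letterAt (fibWord (i + n)) i  ≡⟨ cong (λ m → letterAt (fibWord m) i) (ℕ.+-comm i n) ⟩
  letterAt (fibWord (n + i)) i  ≡⟨ letterAt-≼ (fibWord-≼ i n) i (len-big i) ⟩
  letterAt (fibWord i) i        ∎
  where open ≡-Reasoning

fibWord-repeats : ∀ k → Occurs (fibWord (2 + k)) (len (2 + k))
fibWord-repeats k = occurs-++ʳ W W 0 (occurs-≼ {k = 0} (fibWord-square-≼ k) (fibWord-occurs (4 + k)))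
  where W = fibWord (2 + k)

weight : List Letter → Zφ
weight []       = zeroφ
weight (x ∷ xs) = val x +φ weight xs

weight-++ : ∀ xs ys → weight (xs ++ ys) ≡ weight xs +φ weight ys
weight-++ []       ys = sym (+φ-identityˡ (weight ys))
weight-++ (x ∷ xs) ys =
  trans (cong (val x +φ_) (weight-++ xs ys)) (sym (+φ-assoc (val x) (weight xs) (weight ys)))

-- v(w_{n+1}) = φ^n, since both sides satisfy the Fibonacci recurrence.
weight-fibWord : ∀ n → weight (fibWord n) ≡ φ^ n
weight-fibWord zero          = refl
weight-fibWord (suc zero)    = refl
weight-fibWord (suc (suc n)) = begin
  weight (fibWord (suc n) ++ fibWord n)        ≡⟨ weight-++ (fibWord (suc n)) (fibWord n) ⟩
  weight (fibWord (suc n)) +φ weight (fibWord n) ≡⟨ cong₂ _+φ_ (weight-fibWord (suc n)) (weight-fibWord n) ⟩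
  φ^ (suc n) +φ φ^ n                           ≡⟨ φ^-recurrence n ⟩
  φ^ (suc (suc n))                             ∎
  where open ≡-Reasoning

block : ℕ → ℕ → Zφ
block k zero    = zeroφ
block k (suc j) = val (fibLetter k) +φ block (suc k) j

pos-+ : ∀ k j → pos (k + j) ≡ pos k +φ block k j
pos-+ k zero    = trans (cong pos (ℕ.+-identityʳ k)) (sym (+φ-identityʳ (pos k)))
pos-+ k (suc j) = begin
  pos (k + suc j)                                 ≡⟨ cong pos (ℕ.+-suc k j) ⟩
  pos (suc k + j)                                 ≡⟨ pos-+ (suc k) j ⟩
  (pos k +φ val (fibLetter k)) +φ block (suc k) j ≡⟨ +φ-assoc (pos k) _ _ ⟩
  pos k +φ block k (suc j)                        ∎
  where open ≡-Reasoning

pos≡block : ∀ j → pos j ≡ block 0 j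
pos≡block j = trans (pos-+ 0 j) (+φ-identityˡ (block 0 j))

block-occurs : ∀ xs k → Occurs xs k → block k (length xs) ≡ weight xs
block-occurs []       k occ = refl
block-occurs (x ∷ xs) k occ =
  cong₂ _+φ_ (cong val (occurs-head x xs k occ)) (block-occurs xs (suc k) (occurs-tail x xs k occ))

block-occurs-twice : ∀ xs k l → Occurs xs k → Occurs xs l
  → ∀ j → j ≤ length xs → block k j ≡ block l j
block-occurs-twice xs       k l occₖ occₗ zero    _         = refl
block-occurs-twice (x ∷ xs) k l occₖ occₗ (suc j) (s≤s j≤n) =
  cong₂ _+φ_ (cong val (trans (occurs-head x xs k occₖ) (sym (occurs-head x xs l occₗ))))
    (block-occurs-twice xs (suc k) (suc l) (occurs-tail x xs k occₖ) (occurs-tail x xs l occₗ) j j≤n)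

pos-len : ∀ n → pos (len n) ≡ φ^ n
pos-len n = begin
  pos (len n)              ≡⟨ pos≡block (len n) ⟩
  block 0 (len n)          ≡⟨ block-occurs (fibWord n) 0 (fibWord-occurs n) ⟩
  weight (fibWord n)       ≡⟨ weight-fibWord n ⟩
  φ^ n                     ∎
  where open ≡-Reasoning

pos-shift : ∀ k j → j ≤ len (2 + k) → pos (len (2 + k) + j) ≡ φ^ (2 + k) +φ pos j
pos-shift k j j≤L = begin
  pos (len (2 + k) + j)                ≡⟨ pos-+ (len (2 + k)) j ⟩
  pos (len (2 + k)) +φ block (len (2 + k)) j
    ≡⟨ cong₂ _+φ_ (pos-len (2 + k))
         (block-occurs-twice (fibWord (2 + k)) (len (2 + k)) 0
            (fibWord-repeats k) (fibWord-occurs (2 + k)) j j≤L) ⟩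
  φ^ (2 + k) +φ block 0 j              ≡⟨ cong (φ^ (2 + k) +φ_) (sym (pos≡block j)) ⟩
  φ^ (2 + k) +φ pos j                  ∎
  where open ≡-Reasoning

-- letterSum x y = x + yψ, the value of any word with x letters A and y letters B.
letterSum : ℕ → ℕ → Zφ
letterSum x y = (+ x ℤ.- + y , + y)

letterSum-step : ∀ c x y →
  Σ ℕ λ x′ → Σ ℕ λ y′ → (x′ + y′ ≡ suc (x + y)) × (val c +φ letterSum x y ≡ letterSum x′ y′)
letterSum-step A x y = suc x , y , refl ,
  cong₂ _,_ (trans (add-one (+ x) (+ y)) (cong (ℤ._- + y) (sym (ℤ.pos-+ 1 x)))) (ℤ.+-identityˡ (+ y))
  where
  add-one : ∀ X Y → + 1 ℤ.+ (X ℤ.- Y) ≡ (+ 1 ℤ.+ X) ℤ.- Y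
  add-one = solve-∀
letterSum-step B x y = x , suc y , ℕ.+-suc x y ,
  cong₂ _,_ (trans (add-ψ (+ x) (+ y)) (cong (λ t → + x ℤ.- t) (sym (ℤ.pos-+ 1 y)))) (sym (ℤ.pos-+ 1 y))
  where
  add-ψ : ∀ X Y → ℤ.- + 1 ℤ.+ (X ℤ.- Y) ≡ X ℤ.- (+ 1 ℤ.+ Y)
  add-ψ = solve-∀

block-letterSum : ∀ k j → Σ ℕ λ x → Σ ℕ λ y → (x + y ≡ j) × (block k j ≡ letterSum x y)
block-letterSum k zero = 0 , 0 , refl , refl
block-letterSum k (suc j) with block-letterSum (suc k) j
... | x , y , refl , eq with letterSum-step (fibLetter k) x y
...   | x′ , y′ , len′ , eq′ = x′ , y′ , len′ , trans (cong (val (fibLetter k) +φ_) eq) eq′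

negative : ∀ a b → ¬ (+ 0 ℤ.≤ ℤ.- + (a + suc b))
negative a b rewrite ℕ.+-suc a b = λ ()

norm-negative : ∀ x y → x ≤ suc y → ¬ (+ 0 ℤ.≤ norm (+ suc y ℤ.- + x , ℤ.- + suc y))
norm-negative x y x≤y 0≤N = negative (x * d) (y + y * suc y) (subst (+ 0 ℤ.≤_) norm≡ 0≤N)
  where
  open ≡-Reasoning
  d = suc y ∸ x
  Y = + suc y
  X = + x
  difference : Y ℤ.- X ≡ + d
  difference = trans (ℤ.m-n≡m⊖n (suc y) x) (ℤ.⊖-≥ x≤y)
  norm-formula : ∀ u v → (v ℤ.- u) ℤ.* (v ℤ.- u) ℤ.+ (v ℤ.- u) ℤ.* (ℤ.- v) ℤ.- (ℤ.- v) ℤ.* (ℤ.- v)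
                          ≡ ℤ.- (u ℤ.* (v ℤ.- u) ℤ.+ v ℤ.* v)
  norm-formula = solve-∀
  norm≡ : norm (Y ℤ.- X , ℤ.- Y) ≡ ℤ.- + (x * d + suc y * suc y)
  norm≡ = begin
    norm (Y ℤ.- X , ℤ.- Y)                       ≡⟨ norm-formula X Y ⟩
    ℤ.- (X ℤ.* (Y ℤ.- X) ℤ.+ Y ℤ.* Y)            ≡⟨ cong (λ t → ℤ.- (X ℤ.* t ℤ.+ Y ℤ.* Y)) difference ⟩
    ℤ.- (X ℤ.* + d ℤ.+ Y ℤ.* Y)                  ≡⟨ cong ℤ.-_ (sym (cong₂ ℤ._+_ (ℤ.pos-* x d) (ℤ.pos-* (suc y) (suc y)))) ⟩
    ℤ.- (+ (x * d) ℤ.+ + (suc y * suc y))        ≡⟨ cong ℤ.-_ (sym (ℤ.pos-+ (x * d) (suc y * suc y))) ⟩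
    ℤ.- + (x * d + suc y * suc y)                ∎

letterSum-positive : ∀ x y → 1 ≤ x + y → ¬ NonNeg (+ y ℤ.- + x , ℤ.- + y)
letterSum-positive zero    zero ()
letterSum-positive (suc x) zero _ (inj₁ (() , _))
letterSum-positive (suc x) zero _ (inj₂ (inj₁ ((_ , +<+ ()) , _)))
letterSum-positive (suc x) zero _ (inj₂ (inj₂ ((+<+ () , _) , _)))
letterSum-positive x (suc y) _ (inj₁ (_ , ()))
letterSum-positive x (suc y) _ (inj₂ (inj₁ ((_ , ()) , _)))
letterSum-positive x (suc y) _ (inj₂ (inj₂ ((_ , 0≤Y-X) , 0≤N))) =
  norm-negative x y (ℤ.drop‿+≤+ (ℤ.0≤i-j⇒j≤i {+ suc y} {+ x} 0≤Y-X)) 0≤N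

letterSum-increases : ∀ z x y → 1 ≤ x + y → ¬ ((z +φ letterSum x y) ≤φ z)
letterSum-increases (a , b) x y 1≤n z+s≤z =
  letterSum-positive x y 1≤n (subst NonNeg (cong₂ _,_ (gapˡ a (+ x) (+ y)) (gapʳ b (+ y))) z+s≤z)
  where
  gapˡ : ∀ a X Y → a ℤ.- (a ℤ.+ (X ℤ.- Y)) ≡ Y ℤ.- X
  gapˡ = solve-∀
  gapʳ : ∀ b Y → b ℤ.- (b ℤ.+ Y) ≡ ℤ.- Y
  gapʳ = solve-∀

pos-bounded : ∀ n m → pos m ≤φ φ^ n → m ≤ len n
pos-bounded n m p≤φⁿ with m ≤? len n
... | yes m≤L = m≤L
... | no  m≰L with block-letterSum (len n) (m ∸ len n)
...   | x , y , x+y≡ , block≡ =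
  ⊥-elim (letterSum-increases (φ^ n) x y nonempty (subst (_≤φ φ^ n) pos≡ p≤φⁿ))
  where
  nonempty : 1 ≤ x + y
  nonempty = subst (1 ≤_) (sym x+y≡) (ℕ.m<n⇒0<n∸m (ℕ.≰⇒> m≰L))
  pos≡ : pos m ≡ φ^ n +φ letterSum x y
  pos≡ = begin
    pos m                                ≡⟨ cong pos (sym (ℕ.m+[n∸m]≡n (ℕ.<⇒≤ (ℕ.≰⇒> m≰L)))) ⟩
    pos (len n + (m ∸ len n))            ≡⟨ pos-+ (len n) (m ∸ len n) ⟩
    pos (len n) +φ block (len n) (m ∸ len n) ≡⟨ cong₂ _+φ_ (pos-len n) block≡ ⟩
    φ^ n +φ letterSum x y                ∎
    where open ≡-Reasoning

mainTheorem6 : (p : Zφ) (n : ℕ) → Phinary p → p ≤φ φ^ n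
    → ¬ ((n ≡ 0) × (p ≡ oneφ)) → ¬ ((n ≡ 1) × (p ≡ φ))
    → Phinary (p +φ φ^ n)
mainTheorem6 p n (m , refl) p≤φⁿ not01 not1φ with pos-bounded n (suc m) p≤φⁿ
-- n = 0: L₀ = 1, so p = p₁ = 1, which is excluded.
mainTheorem6 p zero (zero , refl) _ not01 _ | _ = ⊥-elim (not01 (refl , refl))
mainTheorem6 p zero (suc m , refl) _ _ _ | s≤s ()
-- n = 1: L₁ = 2; p = p₁ = 1 gives 1 + φ = p₃, and p = p₂ = φ is excluded.
mainTheorem6 p (suc zero) (zero , refl) _ _ _ | _ = 2 , refl
mainTheorem6 p (suc zero) (suc zero , refl) _ _ not1φ | _ = ⊥-elim (not1φ (refl , refl))
mainTheorem6 p (suc zero) (suc (suc m) , refl) _ _ _ | s≤s (s≤s ())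
-- n ≥ 2: p + φ^n = p_{L_n + m + 1} by the repetition of the partial sums.
mainTheorem6 p (suc (suc k)) (m , refl) _ _ _ | m+1≤L = len (2 + k) + m , (begin
  pos (suc (len (2 + k) + m))   ≡⟨ cong pos (sym (ℕ.+-suc (len (2 + k)) m)) ⟩
  pos (len (2 + k) + suc m)     ≡⟨ pos-shift k (suc m) m+1≤L ⟩
  φ^ (2 + k) +φ pos (suc m)     ≡⟨ +φ-comm (φ^ (2 + k)) (pos (suc m)) ⟩
  pos (suc m) +φ φ^ (2 + k)     ∎)
  where open ≡-Reasoning
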